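{- Let $n>1$, let $k_0,\ldots,k_{n-1}$ be integers and $q,p_0,\ldots,p_{n-1}$ non-zero integers with $\gcd(p_i,q)=1$ for all $i$, and assume $D:=q^n-p_0p_1\cdots p_{n-1}\neq 0$. Extend indices periodically modulo $n$, let $B_i(x)=\frac{p_ix+k_i}{q}$, and let $x_i$ be the unique rational solution of $B_i\circ B_{i+1}\circ\cdots\circ B_{i+n-1}(x)=x$, namely $$x_i=\frac{p_ip_{i+1}\cdots p_{i+n-2}k_{i-1}+p_ip_{i+1}\cdots p_{i+n-3}k_{i-2}q+\cdots+p_ik_{i+1}q^{n-2}+k_iq^{n-1}}{D}.$$ If $x_j$ is an integer for some $j\in\{0,1,\ldots,n-1\}$, then $x_i$ is an integer for every $i=0,1,\ldots,n-1$.
   Context: All indices are taken modulo $n$. -}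

module Defs where

open import Data.Nat as ℕ using (ℕ; zero; suc; NonZero; _∸_)
open import Data.Nat.DivMod using (_%_; m%n<n)
open import Data.Fin using (Fin; toℕ; fromℕ<)
open import Data.Integer as ℤ using (ℤ; +_; -[1+_]; _*_; _+_; _-_; -_; _^_)
open import Data.Rational as ℚ using (ℚ; 0ℚ)
open import Relation.Binary.PropositionalEquality using (_≡_)
open import Data.Product using (∃-syntax)

idx : (n : ℕ) → .{{_ : NonZero n}} → Fin n → ℕ → Fin n
idx n i m = fromℕ< (m%n<n (toℕ i ℕ.+ m) n)

sumℤ : ℕ → (ℕ → ℤ) → ℤ
sumℤ zero    f = + 0
sumℤ (suc l) f = sumℤ l f + f l

prodℤ : ℕ → (ℕ → ℤ) → ℤ
prodℤ zero    f = + 1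
prodℤ (suc l) f = prodℤ l f * f l

pprod : (n : ℕ) → .{{_ : NonZero n}} → (Fin n → ℤ) → Fin n → ℕ → ℤ
pprod n p i m = prodℤ m (λ t → p (idx n i t))

Dval : (n : ℕ) → (Fin n → ℤ) → ℤ → ℤ
Dval zero    p q = q ^ 0 - + 1
Dval (suc n) p q = q ^ suc n - prodℤ (suc n) (λ t → p (idx (suc n) Fin.zero t))
  where import Data.Fin as Fin

-- numerator of x_i :
--   Σ_{m=0}^{n-1} (p_i ⋯ p_{i+m-1}) k_{i+m} q^{n-1-m}
-- = k_i q^{n-1} + p_i k_{i+1} q^{n-2} + ⋯ + p_i ⋯ p_{i+n-2} k_{i-1}
Nval : (n : ℕ) → .{{_ : NonZero n}} → (k p : Fin n → ℤ) → ℤ → Fin n → ℤ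
Nval n k p q i = sumℤ n (λ m → pprod n p i m * k (idx n i m) * q ^ (n ∸ 1 ∸ m))

-- the rational number a / d  (d ≠ 0; the value for d = 0 is irrelevant junk)
fracℤ : ℤ → ℤ → ℚ
fracℤ a (+ zero)   = 0ℚ
fracℤ a (+ suc m)  = a ℚ./ suc m
fracℤ a -[1+ m ]   = (- a) ℚ./ suc m

xval : (n : ℕ) → .{{_ : NonZero n}} → (k p : Fin n → ℤ) → ℤ → Fin n → ℚ
xval n k p q i = fracℤ (Nval n k p q i) (Dval n p q)

IsInteger : ℚ → Set
IsInteger x = ∃[ z ] x ≡ z ℚ./ 1

{-# OPTIONS --safe #-}
-- Write N_s for the numerator of x_s and extend p, k periodically.  Splitting off the first
-- and the last term of N_s gives the recurrence  q N_s = p_s N_{s+1} + k_s D.  Any common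
-- divisor of D and p_s divides p_0 ⋯ p_{n-1}, hence q^n, and is coprime to q, so
-- gcd(D, p_s) = 1.  Therefore D ∣ N_s implies D ∣ N_{s+1}, and going once around the cycle
-- from j reaches every i.
module Submission where

open import Defs
open import Data.Nat as ℕ using (ℕ; NonZero; _>_; zero; suc; _∸_)
open import Data.Nat.Coprimality as ℕC using (coprime-divisor; gcd≡1⇒coprime)
import Data.Nat.Divisibility as ℕD
import Data.Nat.Properties as ℕP
open import Data.Nat.DivMod using (_%_; m%n<n; [m+n]%n≡m%n)
open import Data.Fin using (Fin; toℕ; fromℕ<)
open import Data.Fin.Properties using (toℕ<n; fromℕ<-cong)
open import Data.Integer as ℤ using (ℤ; +_; -[1+_]; _*_; _+_; _-_; -_; _^_; ∣_∣)
open import Data.Integer.Coprimality using (Coprime)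
import Data.Integer.Coprimality as ℤC
open import Data.Integer.Divisibility.Signed
  using (_∣_; divides; ∣ᵤ⇒∣; ∣⇒∣ᵤ; ∣-refl; ∣-trans; ∣m⇒∣-m; ∣m+n∣n⇒∣m; ∣n⇒∣m*n)
open import Data.Integer.GCD using (gcd)
import Data.Integer.Properties as ℤP
open import Data.Integer.Tactic.RingSolver using (solve-∀)
open import Data.Rational.Unnormalised.Base using (mkℚᵘ; *≡*)
open import Data.Rational.Properties using (fromℚᵘ-cong; fromℚᵘ-injective)
open import Data.Product using (_,_)
open import Data.Empty using (⊥-elim)
open import Relation.Binary.PropositionalEquality
  using (_≡_; _≢_; refl; sym; trans; cong; cong₂; subst; module ≡-Reasoning)

sumℤ-cong : ∀ l {f g : ℕ → ℤ} → (∀ m → m ℕ.< l → f m ≡ g m) → sumℤ l f ≡ sumℤ l g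
sumℤ-cong zero    f≗g = refl
sumℤ-cong (suc l) f≗g =
  cong₂ _+_ (sumℤ-cong l (λ m m<l → f≗g m (ℕP.m<n⇒m<1+n m<l))) (f≗g l ℕP.≤-refl)

sumℤ-suc : ∀ l (f : ℕ → ℤ) → sumℤ (suc l) f ≡ f 0 + sumℤ l (λ m → f (suc m))
sumℤ-suc zero    f = ℤP.+-comm (+ 0) (f 0)
sumℤ-suc (suc l) f = trans (cong (_+ f (suc l)) (sumℤ-suc l f)) (ℤP.+-assoc (f 0) _ _)

*-distribˡ-sumℤ : ∀ c l (f : ℕ → ℤ) → c * sumℤ l f ≡ sumℤ l (λ m → c * f m)
*-distribˡ-sumℤ c zero    f = ℤP.*-zeroʳ c
*-distribˡ-sumℤ c (suc l) f =
  trans (ℤP.*-distribˡ-+ c (sumℤ l f) (f l)) (cong (_+ c * f l) (*-distribˡ-sumℤ c l f))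

prodℤ-cong : ∀ l {f g : ℕ → ℤ} → (∀ m → f m ≡ g m) → prodℤ l f ≡ prodℤ l g
prodℤ-cong zero    f≗g = refl
prodℤ-cong (suc l) f≗g = cong₂ _*_ (prodℤ-cong l f≗g) (f≗g l)

prodℤ-suc : ∀ l (f : ℕ → ℤ) → prodℤ (suc l) f ≡ f 0 * prodℤ l (λ m → f (suc m))
prodℤ-suc zero    f = trans (ℤP.*-identityˡ (f 0)) (sym (ℤP.*-identityʳ (f 0)))
prodℤ-suc (suc l) f = trans (cong (_* f (suc l)) (prodℤ-suc l f)) (ℤP.*-assoc (f 0) _ _)

abs-^ : ∀ i k → ∣ i ^ k ∣ ≡ ∣ i ∣ ℕ.^ k
abs-^ i zero    = refl
abs-^ i (suc k) = trans (ℤP.abs-* i (i ^ k)) (cong (∣ i ∣ ℕ.*_) (abs-^ i k))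

coprime-∣^⇒≡1 : ∀ {d m} k → ℕC.Coprime d m → d ℕD.∣ m ℕ.^ k → d ≡ 1
coprime-∣^⇒≡1 zero    d⊥m d∣1   = ℕD.∣1⇒≡1 d∣1
coprime-∣^⇒≡1 (suc k) d⊥m d∣m^k = coprime-∣^⇒≡1 k d⊥m (coprime-divisor d⊥m d∣m^k)

coprime-^-∸ : ∀ {a b q : ℤ} k → Coprime a q → a ∣ b → Coprime (q ^ k - b) a
coprime-^-∸ {b = b} {q} k a⊥q a∣b {d} (d∣D , d∣a) = coprime-∣^⇒≡1 k d⊥q d∣q^k
  where
    d⊥q : ℕC.Coprime d ∣ q ∣
    d⊥q (e∣d , e∣q) = a⊥q (ℕD.∣-trans e∣d d∣a , e∣q)
    d∣b : + d ∣ b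
    d∣b = ∣-trans (∣ᵤ⇒∣ d∣a) a∣b
    d∣q^k : d ℕD.∣ ∣ q ∣ ℕ.^ k
    d∣q^k = subst (d ℕD.∣_) (abs-^ q k) (∣⇒∣ᵤ (∣m+n∣n⇒∣m {m = q ^ k} (∣ᵤ⇒∣ d∣D) (∣m⇒∣-m d∣b)))

coprime-cancelˡ-∣ : ∀ {d a x : ℤ} → Coprime d a → d ∣ a * x → d ∣ x
coprime-cancelˡ-∣ {d} {a} {x} d⊥a d∣ax = ∣ᵤ⇒∣ (ℤC.coprime-divisor d a x d⊥a (∣⇒∣ᵤ d∣ax))

∣⇒fracℤ-isInteger : ∀ d a → d ∣ a → IsInteger (fracℤ a d)
∣⇒fracℤ-isInteger (+ zero)  a _ = + 0 , refl
∣⇒fracℤ-isInteger (+ suc m) a (divides c a≡cd) =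
  c , fromℚᵘ-cong {mkℚᵘ a m} {mkℚᵘ c 0} (*≡* (trans (ℤP.*-identityʳ a) a≡cd))
∣⇒fracℤ-isInteger -[1+ m ]  a (divides c a≡cd) =
  c , fromℚᵘ-cong {mkℚᵘ (- a) m} {mkℚᵘ c 0} (*≡* (begin
    - a * + 1            ≡⟨ ℤP.*-identityʳ (- a) ⟩
    - a                  ≡⟨ cong -_ a≡cd ⟩
    - (c * -[1+ m ])     ≡⟨ ℤP.neg-distribʳ-* c -[1+ m ] ⟩
    c * + suc m          ∎))
  where open ≡-Reasoning

fracℤ-isInteger⇒∣ : ∀ d a → d ≢ + 0 → IsInteger (fracℤ a d) → d ∣ a
fracℤ-isInteger⇒∣ (+ zero)  a d≢0 _ = ⊥-elim (d≢0 refl)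
fracℤ-isInteger⇒∣ (+ suc m) a _ (z , a/d≡z) with fromℚᵘ-injective {mkℚᵘ a m} {mkℚᵘ z 0} a/d≡z
... | *≡* a*1≡zd = divides z (trans (sym (ℤP.*-identityʳ a)) a*1≡zd)
fracℤ-isInteger⇒∣ -[1+ m ]  a _ (z , a/d≡z) with fromℚᵘ-injective {mkℚᵘ (- a) m} {mkℚᵘ z 0} a/d≡z
... | *≡* -a*1≡zd = divides z (begin
    a                    ≡⟨ ℤP.neg-involutive a ⟨
    - - a                ≡⟨ cong -_ (trans (sym (ℤP.*-identityʳ (- a))) -a*1≡zd) ⟩
    - (z * + suc m)      ≡⟨ ℤP.neg-distribʳ-* z (+ suc m) ⟩
    z * -[1+ m ]         ∎)
  where open ≡-Reasoning

module Numerators (n' : ℕ) (p k : ℕ → ℤ) (q : ℤ)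
  (p-periodic : ∀ s → p (suc n' ℕ.+ s) ≡ p s)
  (k-periodic : ∀ s → k (suc n' ℕ.+ s) ≡ k s)
  (p⊥q : ∀ s → Coprime (p s) q) where

  n : ℕ
  n = suc n'

  P : ℕ → ℕ → ℤ
  P s m = prodℤ m (λ t → p (s ℕ.+ t))

  term : ℕ → ℕ → ℤ
  term s m = P s m * k (s ℕ.+ m) * q ^ (n' ∸ m)

  N : ℕ → ℤ
  N s = sumℤ n (term s)

  D : ℤ
  D = q ^ n - P 0 n

  periodic-wrap : ∀ {f : ℕ → ℤ} → (∀ s → f (n ℕ.+ s) ≡ f s) → ∀ s → f (suc s ℕ.+ n') ≡ f s
  periodic-wrap {f} f-periodic s = trans (cong (λ t → f (suc t)) (ℕP.+-comm s n')) (f-periodic s)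

  P-suc : ∀ s m → P s (suc m) ≡ p s * P (suc s) m
  P-suc s m = trans (prodℤ-suc m _)
    (cong₂ _*_ (cong p (ℕP.+-identityʳ s)) (prodℤ-cong m (λ t → cong p (ℕP.+-suc s t))))

  P-rotate : ∀ s → P (suc s) n ≡ P s n
  P-rotate s = begin
    P (suc s) n' * p (suc s ℕ.+ n')  ≡⟨ cong (P (suc s) n' *_) (periodic-wrap p-periodic s) ⟩
    P (suc s) n' * p s               ≡⟨ ℤP.*-comm (P (suc s) n') (p s) ⟩
    p s * P (suc s) n'               ≡⟨ P-suc s n' ⟨
    P s n                            ∎
    where open ≡-Reasoning

  P-cycle : ∀ s → P s n ≡ P 0 n
  P-cycle zero    = refl
  P-cycle (suc s) = trans (P-rotate s) (P-cycle s)

  N-periodic : ∀ s → N (n ℕ.+ s) ≡ N s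
  N-periodic s = sumℤ-cong n (λ m _ →
    cong (_* q ^ (n' ∸ m)) (cong₂ _*_ (prodℤ-cong m (shift p-periodic)) (shift k-periodic m)))
    where
      shift : ∀ {f : ℕ → ℤ} → (∀ s → f (n ℕ.+ s) ≡ f s) → ∀ t → f (n ℕ.+ s ℕ.+ t) ≡ f (s ℕ.+ t)
      shift {f} f-periodic t = trans (cong f (ℕP.+-assoc n s t)) (f-periodic (s ℕ.+ t))

  term-first : ∀ s → term s 0 ≡ k s * q ^ n'
  term-first s = cong (_* q ^ n') (trans (ℤP.*-identityˡ _) (cong k (ℕP.+-identityʳ s)))

  term-last : ∀ s → term (suc s) n' ≡ P (suc s) n' * k s
  term-last s = begin
    P (suc s) n' * k (suc s ℕ.+ n') * q ^ (n' ∸ n')  ≡⟨ cong (λ e → P (suc s) n' * k (suc s ℕ.+ n') * q ^ e) (ℕP.n∸n≡0 n') ⟩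
    P (suc s) n' * k (suc s ℕ.+ n') * + 1            ≡⟨ ℤP.*-identityʳ (P (suc s) n' * k (suc s ℕ.+ n')) ⟩
    P (suc s) n' * k (suc s ℕ.+ n')                  ≡⟨ cong (P (suc s) n' *_) (periodic-wrap k-periodic s) ⟩
    P (suc s) n' * k s                               ∎
    where open ≡-Reasoning

  q*term-suc : ∀ s m → m ℕ.< n' → q * term s (suc m) ≡ p s * term (suc s) m
  q*term-suc s m m<n' = begin
    q * (P s (suc m) * k (s ℕ.+ suc m) * q ^ (n' ∸ suc m))
      ≡⟨ cong₂ (λ u v → q * (u * v * q ^ (n' ∸ suc m))) (P-suc s m) (cong k (ℕP.+-suc s m)) ⟩
    q * (p s * P (suc s) m * k (suc s ℕ.+ m) * q ^ (n' ∸ suc m))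
      ≡⟨ reassociate (p s) (P (suc s) m) (k (suc s ℕ.+ m)) (q ^ (n' ∸ suc m)) q ⟩
    p s * (P (suc s) m * k (suc s ℕ.+ m) * (q * q ^ (n' ∸ suc m)))
      ≡⟨ cong (λ e → p s * (P (suc s) m * k (suc s ℕ.+ m) * q ^ e)) (ℕP.+-∸-assoc 1 m<n') ⟨
    p s * term (suc s) m
      ∎
    where
      open ≡-Reasoning
      reassociate : ∀ (a b c e x : ℤ) → x * (a * b * c * e) ≡ a * (b * c * (x * e))
      reassociate = solve-∀

  q*N≡p*N-suc+k*D : ∀ s → q * N s ≡ p s * N (suc s) + k s * D
  q*N≡p*N-suc+k*D s = begin
    q * N s                                      ≡⟨ cong (q *_) (sumℤ-suc n' (term s)) ⟩
    q * (term s 0 + S)                           ≡⟨ cong (λ u → q * (u + S)) (term-first s) ⟩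
    q * (k s * q ^ n' + S)                       ≡⟨ expand (k s) (q ^ n') S q ⟩
    k s * q ^ n + q * S                          ≡⟨ cong (λ u → k s * q ^ n + u) q*S≡p*T ⟩
    k s * q ^ n + p s * T                        ≡⟨ regroup (k s) (q ^ n) (p s) T Q ⟩
    p s * (T + Q * k s) + k s * (q ^ n - p s * Q)
      ≡⟨ cong₂ (λ u v → p s * (T + u) + k s * (q ^ n - v))
               (sym (term-last s)) (trans (sym (P-suc s n')) (P-cycle s)) ⟩
    p s * N (suc s) + k s * D                    ∎
    where
      open ≡-Reasoning
      S T Q : ℤ
      S = sumℤ n' (λ m → term s (suc m))
      T = sumℤ n' (term (suc s))
      Q = P (suc s) n'
      q*S≡p*T : q * S ≡ p s * T
      q*S≡p*T = trans (*-distribˡ-sumℤ q n' (λ m → term s (suc m)))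
        (trans (sumℤ-cong n' (q*term-suc s)) (sym (*-distribˡ-sumℤ (p s) n' (term (suc s)))))
      expand : ∀ (a b c x : ℤ) → x * (a * b + c) ≡ a * (x * b) + x * c
      expand = solve-∀
      regroup : ∀ (a b c t e : ℤ) → a * b + c * t ≡ c * (t + e * a) + a * (b - c * e)
      regroup = solve-∀

  D⊥p : ∀ s → Coprime D (p s)
  D⊥p s = coprime-^-∸ {q = q} n (p⊥q s)
    (divides Q (trans (sym (P-cycle s)) (trans (P-suc s n') (ℤP.*-comm (p s) Q))))
    where
      Q : ℤ
      Q = P (suc s) n'

  ∣N⇒∣N-suc : ∀ s → D ∣ N s → D ∣ N (suc s)
  ∣N⇒∣N-suc s D∣N = coprime-cancelˡ-∣ {a = p s} (D⊥p s) (∣m+n∣n⇒∣m D∣pN+kD (∣n⇒∣m*n (k s) ∣-refl))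
    where
      D∣pN+kD : D ∣ p s * N (suc s) + k s * D
      D∣pN+kD = subst (D ∣_) (q*N≡p*N-suc+k*D s) (∣n⇒∣m*n q D∣N)

  ∣N⇒∣N-+ : ∀ s m → D ∣ N s → D ∣ N (m ℕ.+ s)
  ∣N⇒∣N-+ s zero    D∣N = D∣N
  ∣N⇒∣N-+ s (suc m) D∣N = ∣N⇒∣N-suc (m ℕ.+ s) (∣N⇒∣N-+ s m D∣N)

  ∣N⇒∣N : ∀ {s} t → s ℕ.≤ n → D ∣ N s → D ∣ N t
  ∣N⇒∣N {s} t s≤n D∣N = subst (D ∣_) (N-periodic t) (subst (λ r → D ∣ N r) once-around
    (∣N⇒∣N-+ s (t ℕ.+ (n ∸ s)) D∣N))
    where
      once-around : t ℕ.+ (n ∸ s) ℕ.+ s ≡ n ℕ.+ t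
      once-around = trans (ℕP.+-assoc t (n ∸ s) s)
        (trans (cong (t ℕ.+_) (ℕP.m∸n+n≡m s≤n)) (ℕP.+-comm t n))

corollary3p5 : (n : ℕ) → .{{_ : NonZero n}} → n > 1 →
    (k p : Fin n → ℤ) → (q : ℤ) →
    q ≢ + 0 → (∀ i → p i ≢ + 0) → (∀ i → gcd (p i) q ≡ + 1) →
    Dval n p q ≢ + 0 →
    (j : Fin n) → IsInteger (xval n k p q j) →
    ∀ i → IsInteger (xval n k p q i)
corollary3p5 n@(suc n') _ k p q _ _ gcd[p,q]≡1 D≢0 j xⱼ∈ℤ i =
  ∣⇒fracℤ-isInteger D _ (∣N⇒∣N (toℕ i) (ℕP.<⇒≤ (toℕ<n j)) (fracℤ-isInteger⇒∣ D _ D≢0 xⱼ∈ℤ))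
  where
    -- With these periodic extensions, Numerators.N (toℕ i) and Numerators.D unfold to
    -- Nval n k p q i and Dval n p q.
    cyclic : (Fin n → ℤ) → ℕ → ℤ
    cyclic f t = f (fromℕ< (m%n<n t n))
    cyclic-periodic : ∀ f s → cyclic f (n ℕ.+ s) ≡ cyclic f s
    cyclic-periodic f s =
      cong f (fromℕ<-cong _ _ (trans (cong (_% n) (ℕP.+-comm n s)) ([m+n]%n≡m%n s n)) _ _)
    open Numerators n' (cyclic p) (cyclic k) q (cyclic-periodic p) (cyclic-periodic k)
      (λ s → gcd≡1⇒coprime (ℤP.+-injective (gcd[p,q]≡1 _)))
      using (D; ∣N⇒∣N)
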